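{- For every $n\in\mathbb N$, $$\varphi^*(n)=\sum_{\substack{d\mid n\\ \kappa(d)=\kappa(n)}}\varphi(d).$$
   Context: $\varphi$ is Euler's totient function. $d\mid\mid n$ means $d\mid n,\ \gcd(d,n/d)=1$; $(j,n)_*=\max\{d: d\mid j,\ d\mid\mid n\}$; $\varphi^*(n)=\#\{1\le j\le n:(j,n)_*=1\}$ is the unitary Euler function. $\kappa(n)=\prod_{p\mid n}p$ is the squarefree kernel. -}

module Defs where

open import Data.Nat using (ℕ; zero; suc; _*_; _≡ᵇ_)
open import Data.Nat.Divisibility using (_∣?_)
open import Data.Nat.DivMod using (_/_)
open import Data.Nat.GCD using (gcd)
open import Data.Nat.Primality using (prime?)
open import Data.Nat.ListAction using (sum; product)
open import Data.Bool using (Bool; true; false; _∧_)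
open import Data.List using (List; map; upTo; filterᵇ; length; foldr)
open import Relation.Nullary.Decidable using (does)
open import Data.Nat using (_⊔_)

range1 : ℕ → List ℕ
range1 n = map suc (upTo n)

_∣ᵇ_ : ℕ → ℕ → Bool
d ∣ᵇ n = does (d ∣? n)

divisors : ℕ → List ℕ
divisors n = filterᵇ (λ d → d ∣ᵇ n) (range1 n)

φ : ℕ → ℕ
φ n = length (filterᵇ (λ j → gcd j n ≡ᵇ 1) (range1 n))

unitaryᵇ : ℕ → ℕ → Bool
unitaryᵇ zero    n = false
unitaryᵇ (suc k) n = (suc k ∣ᵇ n) ∧ (gcd (suc k) (n / suc k) ≡ᵇ 1)

-- (j,n)_* = max { d : d ∣ j, d ∥ n }   (d ranges over 1..n, since d ∥ n forces d ≤ n)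
unitaryGcd : ℕ → ℕ → ℕ
unitaryGcd j n = foldr _⊔_ 0 (filterᵇ (λ d → (d ∣ᵇ j) ∧ unitaryᵇ d n) (range1 n))

φ* : ℕ → ℕ
φ* n = length (filterᵇ (λ j → unitaryGcd j n ≡ᵇ 1) (range1 n))

κ : ℕ → ℕ
κ n = product (filterᵇ (λ p → does (prime? p) ∧ (p ∣ᵇ n)) (range1 n))

rhs : ℕ → ℕ
rhs n = sum (map φ (filterᵇ (λ d → κ d ≡ᵇ κ n) (divisors n)))

-- Write e(j) = n / gcd(j, n). Then (j, n)_* = 1 exactly when every prime divisor of n divides
-- e(j), i.e. κ(e(j)) = κ(n): if a prime p ∣ n does not divide e(j), the full p-power part of n
-- is a unitary divisor of n dividing gcd(j, n); conversely a unitary divisor d ∥ n dividing j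
-- divides gcd(j, n), so e(j) ∣ n/d and d is coprime to e(j), while all its prime factors divide
-- e(j); hence d = 1.
-- Grouping the j ≤ n by the value d = e(j) finishes the proof, since for d ∣ n exactly φ(d) of
-- them have e(j) = d, namely j = (n/d)·k with gcd(k, d) = 1.
module Submission where

open import Defs
open import Algebra.Properties.CommutativeSemigroup using (interchange; x∙yz≈z∙yx; xy∙z≈x∙zy)
open import Data.Bool using (Bool; true; false; if_then_else_; T; _∧_)
open import Data.Bool.Properties using (T-∧)
open import Data.Empty using (⊥-elim)
open import Data.List using (List; []; _∷_; [_]; _++_; map; upTo; filterᵇ; length; foldr)
open import Data.List.Membership.Propositional using (_∈_)
open import Data.List.Membership.Propositional.Properties using (∈-map⁺; ∈-upTo⁺; ∈-filter⁺; ∈-filter⁻)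
open import Data.List.Properties using (map-++; upTo-∷ʳ; filter-++; filter-≐; filter-reject; ++-identityʳ)
open import Data.List.Relation.Unary.All using (All; []; _∷_; tabulate)
open import Data.List.Relation.Unary.Any using (here; there)
open import Data.Nat
  using (ℕ; zero; suc; _+_; _*_; _^_; _≤_; _<_; _≤′_; ≤′-reflexive; ≤′-step; _⊔_; z≤n; s≤s; _≡ᵇ_
        ; NonZero; >-nonZero⁻¹; ≢-nonZero⁻¹)
open import Data.Nat.Coprimality using (Coprime; coprime-divisor; coprime⇒gcd≡1; gcd≡1⇒coprime; 1-coprimeTo)
open import Data.Nat.DivMod using (_/_)
open import Data.Nat.Divisibility
  using (_∣_; divides; _∣?_; 1∣_; _∣0; ∣1⇒≡1; ∣-trans; ∣⇒≤; ∣m+n∣m⇒∣n; m∣m*n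
        ; quotient; quotient≢0; quotient-∣; quotient-<; n/m≡quotient; m∣n⇒n≡m*quotient; m∣n⇒n≡quotient*m)
open import Data.Nat.GCD using (gcd; gcd[m,n]∣m; gcd[m,n]∣n; gcd-greatest; c*gcd[m,n]≡gcd[cm,cn])
open import Data.Nat.Induction using (<-wellFounded)
open import Data.Nat.ListAction using (sum; product)
open import Data.Nat.ListAction.Properties using (sum-++; ∈⇒∣product)
open import Data.Nat.Primality using (Prime; prime?; prime[2]; ¬prime[1]; prime⇒irreducible; prime⇒nonTrivial)
open import Data.Nat.Primality.Factorisation using (factorise; factorisationHasAllPrimeFactors)
open import Data.Nat.Properties
  using (_≟_; ≤-refl; ≤-trans; ≤-antisym; ≤-reflexive; ≤-pred; <-irrefl; ≤∧≢⇒<; ≤⇒≯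
        ; m≤n⇒m≤1+n; ≤⇒≤′; ≤′⇒≤; m≤m⊔n; m≤n⊔m; ⊔-lub
        ; +-identityʳ; +-suc; +-comm; +-assoc; *-identityˡ; *-identityʳ; *-suc; *-zeroʳ; *-comm; *-assoc
        ; *-distribʳ-+; *-cancelˡ-≡; *-cancelʳ-≡; m*n≢0⇒n≢0
        ; +-commutativeSemigroup; *-commutativeSemigroup)
open import Data.Product using (_×_; _,_; proj₁; proj₂; ∃-syntax)
open import Data.Product.Function.NonDependent.Propositional using (_×-⇔_)
open import Data.Sum using (inj₁; inj₂)
open import Function.Base using (_∘_)
open import Function.Bundles using (_⇔_; mk⇔; Equivalence)
open import Function.Construct.Composition using (_⇔-∘_)
open import Induction.WellFounded using (Acc; acc)
open import Relation.Binary.PropositionalEquality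
  using (_≡_; _≢_; refl; sym; trans; cong; cong₂; subst; module ≡-Reasoning)
open import Relation.Nullary using (¬_; yes; no)
open import Relation.Nullary.Decidable using (Dec; does; dec-true; dec-false; does-⇔; T?)
open import Relation.Unary using (_≐_)

open ≡-Reasoning
open Equivalence using (to; from)

T-does : ∀ {P : Set} (P? : Dec P) → T (does P?) ⇔ P
T-does (yes p) = mk⇔ (λ _ → p) _
T-does (no ¬p) = mk⇔ (λ ()) ¬p

T-does-∧ : ∀ {P Q : Set} (P? : Dec P) (Q? : Dec Q) → T (does P? ∧ does Q?) ⇔ (P × Q)
T-does-∧ P? Q? = (T-does P? ×-⇔ T-does Q?) ⇔-∘ T-∧

𝟙 : Bool → ℕ
𝟙 b = if b then 1 else 0

-- ∑[ i ≤ n ] f i = f 1 + ⋯ + f n: the index starts at 1, like range1.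
∑ : ℕ → (ℕ → ℕ) → ℕ
∑ zero    f = 0
∑ (suc n) f = ∑ n f + f (suc n)

syntax ∑ n (λ i → e) = ∑[ i ≤ n ] e

count : ℕ → (ℕ → Bool) → ℕ
count n P = ∑[ i ≤ n ] 𝟙 (P i)

range1-suc : ∀ n → range1 (suc n) ≡ range1 n ++ [ suc n ]
range1-suc n = begin
  map suc (upTo (suc n))    ≡⟨ cong (map suc) (upTo-∷ʳ n) ⟨
  map suc (upTo n ++ [ n ]) ≡⟨ map-++ suc (upTo n) [ n ] ⟩
  range1 n ++ [ suc n ]     ∎

∈-range1⁺ : ∀ {i n} → 1 ≤ i → i ≤ n → i ∈ range1 n
∈-range1⁺ {suc i} _ i<n = ∈-map⁺ suc (∈-upTo⁺ i<n)

sum-map-range1 : ∀ (f : ℕ → ℕ) n → sum (map f (range1 n)) ≡ ∑ n f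
sum-map-range1 f zero    = refl
sum-map-range1 f (suc n) = begin
  sum (map f (range1 (suc n)))             ≡⟨ cong (λ xs → sum (map f xs)) (range1-suc n) ⟩
  sum (map f (range1 n ++ [ suc n ]))      ≡⟨ cong sum (map-++ f (range1 n) [ suc n ]) ⟩
  sum (map f (range1 n) ++ [ f (suc n) ])  ≡⟨ sum-++ (map f (range1 n)) [ f (suc n) ] ⟩
  sum (map f (range1 n)) + (f (suc n) + 0) ≡⟨ cong₂ _+_ (sum-map-range1 f n) (+-identityʳ _) ⟩
  ∑ (suc n) f                              ∎

sum-map-filterᵇ : ∀ (f : ℕ → ℕ) P xs → sum (map f (filterᵇ P xs)) ≡ sum (map (λ x → 𝟙 (P x) * f x) xs)
sum-map-filterᵇ f P []       = refl
sum-map-filterᵇ f P (x ∷ xs) with P x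
... | true  = cong₂ _+_ (sym (+-identityʳ (f x))) (sum-map-filterᵇ f P xs)
... | false = sum-map-filterᵇ f P xs

length-filterᵇ : ∀ P (xs : List ℕ) → length (filterᵇ P xs) ≡ sum (map (λ x → 𝟙 (P x)) xs)
length-filterᵇ P []       = refl
length-filterᵇ P (x ∷ xs) with P x
... | true  = cong suc (length-filterᵇ P xs)
... | false = length-filterᵇ P xs

length-filterᵇ-range1 : ∀ P n → length (filterᵇ P (range1 n)) ≡ count n P
length-filterᵇ-range1 P n = trans (length-filterᵇ P (range1 n)) (sum-map-range1 (λ i → 𝟙 (P i)) n)

∑-cong : ∀ {f g} n → (∀ i → 1 ≤ i → i ≤ n → f i ≡ g i) → ∑ n f ≡ ∑ n g
∑-cong zero    f≗g = refl
∑-cong (suc n) f≗g =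
  cong₂ _+_ (∑-cong n (λ i 1≤i i≤n → f≗g i 1≤i (m≤n⇒m≤1+n i≤n))) (f≗g (suc n) (s≤s z≤n) ≤-refl)

∑-zero : ∀ {f} n → (∀ i → 1 ≤ i → i ≤ n → f i ≡ 0) → ∑ n f ≡ 0
∑-zero zero    f≗0 = refl
∑-zero (suc n) f≗0 =
  cong₂ _+_ (∑-zero n (λ i 1≤i i≤n → f≗0 i 1≤i (m≤n⇒m≤1+n i≤n))) (f≗0 (suc n) (s≤s z≤n) ≤-refl)

∑-+ : ∀ f g n → ∑[ i ≤ n ] (f i + g i) ≡ ∑ n f + ∑ n g
∑-+ f g zero    = refl
∑-+ f g (suc n) = trans (cong (_+ (f (suc n) + g (suc n))) (∑-+ f g n))
                        (interchange +-commutativeSemigroup (∑ n f) (∑ n g) (f (suc n)) (g (suc n)))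

∑-*ʳ : ∀ f c n → ∑[ i ≤ n ] (f i * c) ≡ ∑ n f * c
∑-*ʳ f c zero    = refl
∑-*ʳ f c (suc n) = trans (cong (_+ f (suc n) * c) (∑-*ʳ f c n)) (sym (*-distribʳ-+ c (∑ n f) (f (suc n))))

∑-comm : ∀ (F : ℕ → ℕ → ℕ) m n → ∑[ i ≤ m ] ∑[ j ≤ n ] F i j ≡ ∑[ j ≤ n ] ∑[ i ≤ m ] F i j
∑-comm F zero    n = sym (∑-zero n (λ _ _ _ → refl))
∑-comm F (suc m) n = trans (cong (_+ ∑[ j ≤ n ] F (suc m) j) (∑-comm F m n))
                           (sym (∑-+ (λ j → ∑[ i ≤ m ] F i j) (F (suc m)) n))

∑-δ : ∀ (f : ℕ → ℕ) {e} n → 1 ≤ e → e ≤ n → ∑[ i ≤ n ] (𝟙 (e ≡ᵇ i) * f i) ≡ f e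
∑-δ f zero    () z≤n
∑-δ f {e} (suc n) 1≤e e≤1+n with e ≟ suc n
... | yes refl = begin
  ∑[ i ≤ n ] (𝟙 (e ≡ᵇ i) * f i) + 𝟙 (e ≡ᵇ e) * f e ≡⟨ cong₂ _+_ (∑-zero n below-e) (cong (λ b → 𝟙 b * f e) (dec-true (e ≟ e) refl)) ⟩
  f e + 0                                          ≡⟨ +-identityʳ (f e) ⟩
  f e                                              ∎
  where
  below-e : ∀ i → 1 ≤ i → i ≤ n → 𝟙 (e ≡ᵇ i) * f i ≡ 0
  below-e i _ i≤n = cong (λ b → 𝟙 b * f i) (dec-false (e ≟ i) λ { refl → <-irrefl refl (s≤s i≤n) })
... | no e≢1+n = begin
  ∑[ i ≤ n ] (𝟙 (e ≡ᵇ i) * f i) + 𝟙 (e ≡ᵇ suc n) * f (suc n) ≡⟨ cong₂ _+_ (∑-δ f n 1≤e (≤-pred (≤∧≢⇒< e≤1+n e≢1+n)))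
                                                                (cong (λ b → 𝟙 b * f (suc n)) (dec-false (e ≟ suc n) e≢1+n)) ⟩
  f e + 0                                                    ≡⟨ +-identityʳ (f e) ⟩
  f e                                                        ∎

∑-split : ∀ f m k → ∑ (m + k) f ≡ ∑ m f + ∑[ i ≤ k ] f (m + i)
∑-split f m zero    = trans (cong (λ n → ∑ n f) (+-identityʳ m)) (sym (+-identityʳ (∑ m f)))
∑-split f m (suc k) = begin
  ∑ (m + suc k) f                              ≡⟨ cong (λ n → ∑ n f) (+-suc m k) ⟩
  ∑ (m + k) f + f (suc (m + k))                ≡⟨ cong₂ _+_ (∑-split f m k) (cong f (sym (+-suc m k))) ⟩
  ∑ m f + ∑[ i ≤ k ] f (m + i) + f (m + suc k) ≡⟨ +-assoc (∑ m f) _ _ ⟩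
  ∑ m f + ∑[ i ≤ suc k ] f (m + i)             ∎

∑-multiples : ∀ f q n → .{{NonZero q}} → (∀ i → ¬ q ∣ i → f i ≡ 0) →
              ∑ (q * n) f ≡ ∑[ k ≤ n ] f (q * k)
∑-multiples f q          zero    f≗0 = cong (λ n → ∑ n f) (*-zeroʳ q)
∑-multiples f q@(suc q′) (suc n) f≗0 = begin
  ∑ (q * suc n) f                                           ≡⟨ cong (λ m → ∑ m f) q[1+n]≡qn+q ⟩
  ∑ (q * n + q) f                                           ≡⟨ ∑-split f (q * n) q ⟩
  ∑ (q * n) f + (∑[ i ≤ q′ ] f (q * n + i) + f (q * n + q)) ≡⟨ cong₂ _+_ (∑-multiples f q n f≗0)
                                                                  (cong₂ _+_ (∑-zero q′ strictly-between) (cong f (sym q[1+n]≡qn+q))) ⟩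
  ∑[ k ≤ suc n ] f (q * k)                                  ∎
  where
  q[1+n]≡qn+q : q * suc n ≡ q * n + q
  q[1+n]≡qn+q = trans (*-suc q n) (+-comm q (q * n))
  strictly-between : ∀ i → 1 ≤ i → i ≤ q′ → f (q * n + i) ≡ 0
  strictly-between i@(suc _) _ i≤q′ = f≗0 (q * n + i) λ q∣qn+i →
    <-irrefl refl (≤-trans (s≤s (∣⇒≤ (∣m+n∣m⇒∣n q∣qn+i (m∣m*n n)))) (s≤s i≤q′))

∑-fibres : ∀ (h c : ℕ → ℕ) m n → (∀ j → 1 ≤ j → j ≤ n → 1 ≤ c j × c j ≤ m) →
           ∑[ j ≤ n ] h (c j) ≡ ∑[ d ≤ m ] (count n (λ j → c j ≡ᵇ d) * h d)
∑-fibres h c m n c-bounded = begin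
  ∑[ j ≤ n ] h (c j)                          ≡⟨ ∑-cong n (λ j 1≤j j≤n → let (1≤cj , cj≤m) = c-bounded j 1≤j j≤n in
                                                                        sym (∑-δ h m 1≤cj cj≤m)) ⟩
  ∑[ j ≤ n ] ∑[ d ≤ m ] (𝟙 (c j ≡ᵇ d) * h d)  ≡⟨ ∑-comm (λ j d → 𝟙 (c j ≡ᵇ d) * h d) n m ⟩
  ∑[ d ≤ m ] ∑[ j ≤ n ] (𝟙 (c j ≡ᵇ d) * h d)  ≡⟨ ∑-cong m (λ d _ _ → ∑-*ʳ (λ j → 𝟙 (c j ≡ᵇ d)) (h d) n) ⟩
  ∑[ d ≤ m ] (count n (λ j → c j ≡ᵇ d) * h d) ∎

-- Counting the j with a given n / gcd(j, n)

divisor-nonZero : ∀ {d n} → .{{NonZero n}} → d ∣ n → NonZero d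
divisor-nonZero {{n≢0}} (divides q n≡qd) = m*n≢0⇒n≢0 q {{subst NonZero n≡qd n≢0}}

-- n / gcd j n, as the quotient of a divisibility witness so that no NonZero instance is needed.
cofactor : ℕ → ℕ → ℕ
cofactor j n = quotient (gcd[m,n]∣n j n)

cofactor*gcd : ∀ j n → n ≡ cofactor j n * gcd j n
cofactor*gcd j n = m∣n⇒n≡quotient*m (gcd[m,n]∣n j n)

cofactor∣ : ∀ j n → cofactor j n ∣ n
cofactor∣ j n = quotient-∣ (gcd[m,n]∣n j n)

cofactor-bounds : ∀ j n → .{{NonZero n}} → 1 ≤ cofactor j n × cofactor j n ≤ n
cofactor-bounds j n = >-nonZero⁻¹ _ {{quotient≢0 (gcd[m,n]∣n j n)}} , ∣⇒≤ (cofactor∣ j n)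

cofactor≡⇔gcd≡ : ∀ j {n q d} → .{{NonZero q}} → .{{NonZero d}} → n ≡ q * d →
                 cofactor j n ≡ d ⇔ gcd j n ≡ q
cofactor≡⇔gcd≡ j {n} {q} {d} n≡qd = mk⇔
  (λ c≡d → *-cancelˡ-≡ _ _ d (trans (cong (_* gcd j n) (sym c≡d)) (trans (sym (cofactor*gcd j n)) n≡dq)))
  (λ g≡q → *-cancelʳ-≡ _ _ q (trans (cong (cofactor j n *_) (sym g≡q)) (trans (sym (cofactor*gcd j n)) n≡dq)))
  where
  n≡dq : n ≡ d * q
  n≡dq = trans n≡qd (*-comm q d)

count-cofactor : ∀ n d → .{{NonZero n}} → count n (λ j → cofactor j n ≡ᵇ d) ≡ 𝟙 (d ∣ᵇ n) * φ d
count-cofactor n d with d ∣? n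
... | no d∤n = ∑-zero n (λ j _ _ → cong 𝟙 (dec-false (cofactor j n ≟ d) λ { refl → d∤n (cofactor∣ j n) }))
... | yes d∣n@(divides q n≡qd) = begin
  ∑[ j ≤ n ] 𝟙 (cofactor j n ≡ᵇ d)       ≡⟨ cong (λ m → ∑[ j ≤ m ] 𝟙 (cofactor j n ≡ᵇ d)) n≡qd ⟩
  ∑[ j ≤ q * d ] 𝟙 (cofactor j n ≡ᵇ d)   ≡⟨ ∑-multiples _ q d off-multiples ⟩
  ∑[ k ≤ d ] 𝟙 (cofactor (q * k) n ≡ᵇ d) ≡⟨ ∑-cong d (λ k _ _ → cong 𝟙 (does-⇔ (coprime-fibre k) (_ ≟ _) (_ ≟ _))) ⟩
  count d (λ k → gcd k d ≡ᵇ 1)           ≡⟨ length-filterᵇ-range1 _ d ⟨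
  φ d                                    ≡⟨ +-identityʳ (φ d) ⟨
  1 * φ d                                ∎
  where
  instance
    q≢0 : NonZero q
    q≢0 = quotient≢0 d∣n
    d≢0 : NonZero d
    d≢0 = divisor-nonZero d∣n
  off-multiples : ∀ i → ¬ q ∣ i → 𝟙 (cofactor i n ≡ᵇ d) ≡ 0
  off-multiples i q∤i = cong 𝟙 (dec-false (cofactor i n ≟ d) λ c≡d →
    q∤i (subst (_∣ i) (to (cofactor≡⇔gcd≡ i n≡qd) c≡d) (gcd[m,n]∣m i n)))
  coprime-fibre : ∀ k → cofactor (q * k) n ≡ d ⇔ gcd k d ≡ 1
  coprime-fibre k = gcd≡q⇔coprime ⇔-∘ cofactor≡⇔gcd≡ (q * k) n≡qd
    where
    gcd[qk,n] : gcd (q * k) n ≡ q * gcd k d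
    gcd[qk,n] = trans (cong (gcd (q * k)) n≡qd) (sym (c*gcd[m,n]≡gcd[cm,cn] q k d))
    gcd≡q⇔coprime : gcd (q * k) n ≡ q ⇔ gcd k d ≡ 1
    gcd≡q⇔coprime = mk⇔
      (λ g≡q → *-cancelˡ-≡ _ 1 q (trans (sym gcd[qk,n]) (trans g≡q (sym (*-identityʳ q)))))
      (λ g≡1 → trans gcd[qk,n] (trans (cong (q *_) g≡1) (*-identityʳ q)))

-- Unitary divisors

infix 4 _∥_

_∥_ : ℕ → ℕ → Set
d ∥ n = ∃[ m ] n ≡ d * m × Coprime d m

∥⇒∣ : ∀ {d n} → d ∥ n → d ∣ n
∥⇒∣ {d} (m , n≡dm , _) = divides m (trans n≡dm (*-comm d m))

1∥_ : ∀ n → 1 ∥ n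
1∥ n = n , sym (*-identityˡ n) , 1-coprimeTo n

UnitarilyCoprime : ℕ → ℕ → Set
UnitarilyCoprime j n = ∀ {d} → d ∣ j → d ∥ n → d ≡ 1

T-unitaryᵇ : ∀ k n → T (unitaryᵇ (suc k) n) ⇔ suc k ∥ n
T-unitaryᵇ k n = mk⇔ unitary divides-coprime ⇔-∘ T-does-∧ (d ∣? n) (gcd d (n / d) ≟ 1)
  where
  d = suc k
  unitary : d ∣ n × gcd d (n / d) ≡ 1 → d ∥ n
  unitary (d∣n , coprime) = quotient d∣n , m∣n⇒n≡m*quotient d∣n ,
    gcd≡1⇒coprime (subst (λ m → gcd d m ≡ 1) (n/m≡quotient d∣n) coprime)
  divides-coprime : d ∥ n → d ∣ n × gcd d (n / d) ≡ 1
  divides-coprime d∥n@(_ , _ , coprime) =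
    ∥⇒∣ d∥n , subst (λ m → gcd d m ≡ 1) (sym (n/m≡quotient (∥⇒∣ d∥n))) (coprime⇒gcd≡1 coprime)

commonUnitaryDivisor? : ℕ → ℕ → ℕ → Bool
commonUnitaryDivisor? j n d = (d ∣ᵇ j) ∧ unitaryᵇ d n

T-commonUnitaryDivisor? : ∀ j n d → .{{NonZero n}} → T (commonUnitaryDivisor? j n d) ⇔ (d ∣ j × d ∥ n)
T-commonUnitaryDivisor? j n zero    = mk⇔ (λ t → ⊥-elim (proj₂ (to (T-∧ {0 ∣ᵇ j}) t)))
                                          (λ (_ , _ , n≡0 , _) → ⊥-elim (≢-nonZero⁻¹ n n≡0))
T-commonUnitaryDivisor? j n (suc k) = (T-does (suc k ∣? j) ×-⇔ T-unitaryᵇ k n) ⇔-∘ T-∧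

unitaryGcd≡1⇔unitarilyCoprime : ∀ j n → .{{NonZero n}} → unitaryGcd j n ≡ 1 ⇔ UnitarilyCoprime j n
unitaryGcd≡1⇔unitarilyCoprime j n = mk⇔
  (λ gcd*≡1 {d} d∣j d∥n → ≤-antisym (subst (d ≤_) gcd*≡1 (≤-max (∈-common⁺ d∣j d∥n)))
                                     (>-nonZero⁻¹ d {{divisor-nonZero (∥⇒∣ d∥n)}}))
  (λ coprime* → ≤-antisym (max-≤ (tabulate λ d∈ → let (d∣j , d∥n) = ∈-common⁻ d∈ in ≤-reflexive (coprime* d∣j d∥n)))
                          (≤-max (∈-common⁺ (1∣ j) (1∥ n))))
  where
  common = filterᵇ (commonUnitaryDivisor? j n) (range1 n)
  ∈-common⁺ : ∀ {d} → d ∣ j → d ∥ n → d ∈ common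
  ∈-common⁺ {d} d∣j d∥n = ∈-filter⁺ (T? ∘ commonUnitaryDivisor? j n)
    (∈-range1⁺ (>-nonZero⁻¹ d {{divisor-nonZero (∥⇒∣ d∥n)}}) (∣⇒≤ (∥⇒∣ d∥n)))
    (from (T-commonUnitaryDivisor? j n d) (d∣j , d∥n))
  ∈-common⁻ : ∀ {d} → d ∈ common → d ∣ j × d ∥ n
  ∈-common⁻ {d} d∈ = to (T-commonUnitaryDivisor? j n d) (proj₂ (∈-filter⁻ (T? ∘ commonUnitaryDivisor? j n) {xs = range1 n} d∈))
  ≤-max : ∀ {x xs} → x ∈ xs → x ≤ foldr _⊔_ 0 xs
  ≤-max {xs = y ∷ _} (here refl) = m≤m⊔n y _
  ≤-max {xs = y ∷ _} (there x∈)  = ≤-trans (≤-max x∈) (m≤n⊔m y _)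
  max-≤ : ∀ {b xs} → All (_≤ b) xs → foldr _⊔_ 0 xs ≤ b
  max-≤ []             = z≤n
  max-≤ (x≤b ∷ xs≤b) = ⊔-lub x≤b (max-≤ xs≤b)

-- Prime factors

∃-prime-divisor : ∀ {n} → n ≢ 1 → ∃[ p ] Prime p × p ∣ n
∃-prime-divisor {zero} _ = 2 , prime[2] , 2 ∣0
∃-prime-divisor {n@(suc _)} n≢1 with factorise n
... | record { factors = [] ; isFactorisation = n≡1 } = ⊥-elim (n≢1 n≡1)
... | record { factors = p ∷ ps ; isFactorisation = n≡Πps ; factorsPrime = p-prime ∷ _ } =
  p , p-prime , subst (p ∣_) (sym n≡Πps) (∈⇒∣product {ns = p ∷ ps} (here refl))

coprime∧primeDivisors∣⇒≡1 : ∀ {d e} → Coprime d e → (∀ {p} → Prime p → p ∣ d → p ∣ e) → d ≡ 1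
coprime∧primeDivisors∣⇒≡1 {d} coprime primes∣e with d ≟ 1
... | yes d≡1 = d≡1
... | no d≢1 with ∃-prime-divisor d≢1
...   | p , p-prime , p∣d = ⊥-elim (¬prime[1] (subst Prime (coprime (p∣d , primes∣e p-prime p∣d)) p-prime))

coprime-^ : ∀ {p m} → Prime p → ¬ p ∣ m → ∀ a → Coprime (p ^ a) m
coprime-^ _ _ zero (i∣1 , _) = ∣1⇒≡1 i∣1
coprime-^ {p} p-prime p∤m (suc a) {i} (i∣p^[1+a] , i∣m) with prime⇒irreducible p-prime (gcd[m,n]∣n i p)
... | inj₁ gcd≡1 = coprime-^ p-prime p∤m a (coprime-divisor (gcd≡1⇒coprime gcd≡1) i∣p^[1+a] , i∣m)
... | inj₂ gcd≡p = ⊥-elim (p∤m (∣-trans (subst (_∣ i) gcd≡p (gcd[m,n]∣m i p)) i∣m))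

prime-power-split : ∀ {p} → Prime p → ∀ n → .{{NonZero n}} → ∃[ a ] ∃[ m ] n ≡ p ^ a * m × ¬ p ∣ m
prime-power-split {p} p-prime n = split n (<-wellFounded n)
  where
  instance
    p>1 = prime⇒nonTrivial p-prime
  split : ∀ n → .{{NonZero n}} → Acc _<_ n → ∃[ a ] ∃[ m ] n ≡ p ^ a * m × ¬ p ∣ m
  split n (acc rec) with p ∣? n
  ... | no p∤n = 0 , n , sym (*-identityˡ n) , p∤n
  ... | yes p∣n@(divides q n≡qp) with split q {{quotient≢0 p∣n}} (rec (quotient-< p∣n))
  ...   | a , m , q≡pᵃm , p∤m = suc a , m , n≡p^[1+a]m , p∤m
    where
    n≡p^[1+a]m : n ≡ p ^ suc a * m
    n≡p^[1+a]m = begin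
      n               ≡⟨ n≡qp ⟩
      q * p           ≡⟨ *-comm q p ⟩
      p * q           ≡⟨ cong (p *_) q≡pᵃm ⟩
      p * (p ^ a * m) ≡⟨ *-assoc p (p ^ a) m ⟨
      p ^ suc a * m   ∎

unitarilyCoprime⇔primes∣cofactor : ∀ j n → .{{NonZero n}} →
                                   UnitarilyCoprime j n ⇔ (∀ {p} → Prime p → p ∣ n → p ∣ cofactor j n)
unitarilyCoprime⇔primes∣cofactor j n = mk⇔ primes∣cofactor unitarilyCoprime
  where
  primes∣cofactor : UnitarilyCoprime j n → ∀ {p} → Prime p → p ∣ n → p ∣ cofactor j n
  primes∣cofactor coprime* {p} p-prime p∣n with p ∣? cofactor j n
  ... | yes p∣c = p∣c
  ... | no p∤c with prime-power-split p-prime n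
  ...   | a , m , n≡pᵃm , p∤m = ⊥-elim (p∤m (subst (p ∣_) n≡m p∣n))
    where
    pᵃ∥n : p ^ a ∥ n
    pᵃ∥n = m , n≡pᵃm , coprime-^ p-prime p∤m a
    pᵃ∣j : p ^ a ∣ j
    pᵃ∣j = ∣-trans (coprime-divisor (coprime-^ p-prime p∤c a) (subst (p ^ a ∣_) (cofactor*gcd j n) (∥⇒∣ pᵃ∥n)))
                   (gcd[m,n]∣m j n)
    n≡m : n ≡ m
    n≡m = trans n≡pᵃm (trans (cong (_* m) (coprime* pᵃ∣j pᵃ∥n)) (*-identityˡ m))
  unitarilyCoprime : (∀ {p} → Prime p → p ∣ n → p ∣ cofactor j n) → UnitarilyCoprime j n
  unitarilyCoprime primes∣c {d} d∣j d∥n@(m , n≡dm , coprime) = coprime∧primeDivisors∣⇒≡1 coprime[d,c]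
    (λ p-prime p∣d → primes∣c p-prime (∣-trans p∣d (∥⇒∣ d∥n)))
    where
    instance
      d≢0 = divisor-nonZero (∥⇒∣ d∥n)
    c∣m : cofactor j n ∣ m
    c∣m with gcd-greatest d∣j (∥⇒∣ d∥n)
    ... | divides k g≡kd = divides k (*-cancelˡ-≡ m (k * cofactor j n) d (begin
      d * m                  ≡⟨ n≡dm ⟨
      n                      ≡⟨ cofactor*gcd j n ⟩
      cofactor j n * gcd j n ≡⟨ cong (cofactor j n *_) g≡kd ⟩
      cofactor j n * (k * d) ≡⟨ x∙yz≈z∙yx *-commutativeSemigroup (cofactor j n) k d ⟩
      d * (k * cofactor j n) ∎))
    coprime[d,c] : Coprime d (cofactor j n)
    coprime[d,c] (i∣d , i∣c) = coprime (i∣d , ∣-trans i∣c c∣m)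

-- The squarefree kernel

filterᵇ-range1-≤ : ∀ (P : ℕ → Bool) {m n} → m ≤ n → (∀ {i} → m < i → ¬ T (P i)) →
                   filterᵇ P (range1 n) ≡ filterᵇ P (range1 m)
filterᵇ-range1-≤ P {m} m≤n beyond-m = extend (≤⇒≤′ m≤n)
  where
  extend : ∀ {n} → m ≤′ n → filterᵇ P (range1 n) ≡ filterᵇ P (range1 m)
  extend (≤′-reflexive refl) = refl
  extend {suc n} (≤′-step m≤′n) = begin
    filterᵇ P (range1 (suc n))                  ≡⟨ cong (filterᵇ P) (range1-suc n) ⟩
    filterᵇ P (range1 n ++ [ suc n ])           ≡⟨ filter-++ (T? ∘ P) (range1 n) [ suc n ] ⟩
    filterᵇ P (range1 n) ++ filterᵇ P [ suc n ] ≡⟨ cong₂ _++_ (extend m≤′n)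
                                                            (filter-reject (T? ∘ P) (beyond-m (s≤s (≤′⇒≤ m≤′n)))) ⟩
    filterᵇ P (range1 m) ++ []                  ≡⟨ ++-identityʳ _ ⟩
    filterᵇ P (range1 m)                        ∎

primeDivisor? : ℕ → ℕ → Bool
primeDivisor? n p = does (prime? p) ∧ (p ∣ᵇ n)

primeDivisors : ℕ → List ℕ
primeDivisors n = filterᵇ (primeDivisor? n) (range1 n)

∈-primeDivisors⁺ : ∀ {p n} → .{{NonZero n}} → Prime p → p ∣ n → p ∈ primeDivisors n
∈-primeDivisors⁺ {p} {n} p-prime p∣n =
  ∈-filter⁺ (T? ∘ primeDivisor? n) (∈-range1⁺ (>-nonZero⁻¹ p {{divisor-nonZero p∣n}}) (∣⇒≤ p∣n))
    (from (T-does-∧ (prime? p) (p ∣? n)) (p-prime , p∣n))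

∈-primeDivisors⁻ : ∀ {p n} → p ∈ primeDivisors n → Prime p × p ∣ n
∈-primeDivisors⁻ {p} {n} p∈ = to (T-does-∧ (prime? p) (p ∣? n)) (proj₂ (∈-filter⁻ (T? ∘ primeDivisor? n) {xs = range1 n} p∈))

primes∣⇔κ≡κ : ∀ {m n} → .{{NonZero n}} → m ∣ n → (∀ {p} → Prime p → p ∣ n → p ∣ m) ⇔ κ m ≡ κ n
primes∣⇔κ≡κ {m} {n} m∣n = mk⇔ (cong product ∘ same-primeDivisors) primes∣m
  where
  instance
    m≢0 = divisor-nonZero m∣n
  same-primeDivisors : (∀ {p} → Prime p → p ∣ n → p ∣ m) → primeDivisors m ≡ primeDivisors n
  same-primeDivisors primes∣m = begin
    filterᵇ (primeDivisor? m) (range1 m) ≡⟨ filterᵇ-range1-≤ (primeDivisor? m) (∣⇒≤ m∣n) beyond-m ⟨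
    filterᵇ (primeDivisor? m) (range1 n) ≡⟨ filter-≐ (T? ∘ primeDivisor? m) (T? ∘ primeDivisor? n) same-predicate (range1 n) ⟩
    filterᵇ (primeDivisor? n) (range1 n) ∎
    where
    beyond-m : ∀ {i} → m < i → ¬ T (primeDivisor? m i)
    beyond-m {i} m<i t = ≤⇒≯ (∣⇒≤ (proj₂ (to (T-does-∧ (prime? i) (i ∣? m)) t))) m<i
    same-predicate : (T ∘ primeDivisor? m) ≐ (T ∘ primeDivisor? n)
    same-predicate =
      (λ {i} t → let (i-prime , i∣m) = to (T-does-∧ (prime? i) (i ∣? m)) t in
                 from (T-does-∧ (prime? i) (i ∣? n)) (i-prime , ∣-trans i∣m m∣n)) ,
      (λ {i} t → let (i-prime , i∣n) = to (T-does-∧ (prime? i) (i ∣? n)) t in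
                 from (T-does-∧ (prime? i) (i ∣? m)) (i-prime , primes∣m i-prime i∣n))
  primes∣m : κ m ≡ κ n → ∀ {p} → Prime p → p ∣ n → p ∣ m
  primes∣m κm≡κn {p} p-prime p∣n = proj₂ (∈-primeDivisors⁻ (factorisationHasAllPrimeFactors p-prime p∣κm
    (tabulate (proj₁ ∘ ∈-primeDivisors⁻ {n = m}))))
    where
    p∣κm : p ∣ κ m
    p∣κm = subst (p ∣_) (sym κm≡κn) (∈⇒∣product (∈-primeDivisors⁺ p-prime p∣n))

unitaryGcd≡1⇔κ[cofactor]≡κ : ∀ j n → .{{NonZero n}} → unitaryGcd j n ≡ 1 ⇔ κ (cofactor j n) ≡ κ n
unitaryGcd≡1⇔κ[cofactor]≡κ j n =
  primes∣⇔κ≡κ (cofactor∣ j n) ⇔-∘ (unitarilyCoprime⇔primes∣cofactor j n ⇔-∘ unitaryGcd≡1⇔unitarilyCoprime j n)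

corollary3 : (n : ℕ) → φ* (suc n) ≡ rhs (suc n)
corollary3 n = begin
  φ* N                                                               ≡⟨ length-filterᵇ-range1 _ N ⟩
  count N (λ j → unitaryGcd j N ≡ᵇ 1)                                ≡⟨ ∑-cong N (λ j _ _ → cong 𝟙 (criterion j)) ⟩
  ∑[ j ≤ N ] 𝟙 (sameKernel (cofactor j N))                           ≡⟨ ∑-fibres (𝟙 ∘ sameKernel) (λ j → cofactor j N) N N
                                                                                  (λ j _ _ → cofactor-bounds j N) ⟩
  ∑[ d ≤ N ] (count N (λ j → cofactor j N ≡ᵇ d) * 𝟙 (sameKernel d))  ≡⟨ ∑-cong N (λ d _ _ → cong (_* 𝟙 (sameKernel d)) (count-cofactor N d)) ⟩
  ∑[ d ≤ N ] (𝟙 (d ∣ᵇ N) * φ d * 𝟙 (sameKernel d))                   ≡⟨ ∑-cong N (λ d _ _ → xy∙z≈x∙zy *-commutativeSemigroup (𝟙 (d ∣ᵇ N)) (φ d) _) ⟩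
  ∑[ d ≤ N ] (𝟙 (d ∣ᵇ N) * (𝟙 (sameKernel d) * φ d))                 ≡⟨ sum-map-range1 _ N ⟨
  sum (map (λ d → 𝟙 (d ∣ᵇ N) * (𝟙 (sameKernel d) * φ d)) (range1 N)) ≡⟨ sum-map-filterᵇ _ (_∣ᵇ N) (range1 N) ⟨
  sum (map (λ d → 𝟙 (sameKernel d) * φ d) (divisors N))              ≡⟨ sum-map-filterᵇ φ sameKernel (divisors N) ⟨
  rhs N                                                              ∎
  where
  N = suc n
  sameKernel : ℕ → Bool
  sameKernel d = κ d ≡ᵇ κ N
  criterion : ∀ j → (unitaryGcd j N ≡ᵇ 1) ≡ sameKernel (cofactor j N)
  criterion j = does-⇔ (unitaryGcd≡1⇔κ[cofactor]≡κ j N) (_ ≟ _) (_ ≟ _)
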